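{- Let $n\geq 8$ and let $H$ be a skew-Hadamard matrix of order $n$ of the form $$H=\begin{bmatrix}1 & \mathbf{1}^T\\ -\mathbf{1} & I_{n-1}+A_1-A_2\end{bmatrix},$$ where $A_1,A_2$ are $(n-1)\times(n-1)$ $\{0,1\}$-matrices with $A_1^T=A_2$; set $A_0=I_{n-1}$. Define the $(2n-1)\times(2n-1)$ matrix $$B_1=\begin{bmatrix} A_1 & \mathbf{0} & A_0+A_1\\ \mathbf{1}^T & 0 & \mathbf{0}^T\\ A_1 & \mathbf{1} & A_2\end{bmatrix}$$ (blocks of sizes $n-1,1,n-1$), $B_0=I_{2n-1}$, $B_2=B_1^T$, and $\mathfrak{Y}=\{B_0,B_1,B_2\}$ (a non-symmetric class $2$ association scheme). Then each of the sets $\{1,\dots,n-1\}$, $\{n\}$, $\{n+1,\dots,2n-1\}$ is mapped to itself by every element of $\operatorname{Aut}(\mathfrak{Y})$.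
   Context: A Hadamard matrix of order $n$ is an $n\times n$ $\pm1$-matrix with $HH^T=nI_n$; it is skew if $H-I_n$ is skew-symmetric. $\mathbf{0},\mathbf{1}$ are the all-zero and all-one column vectors of length $n-1$. For a scheme $\mathfrak{Y}=\{B_0,\dots,B_d\}$ of order $N$, $\operatorname{Aut}(\mathfrak{Y})=\{\sigma\in S_N : P_\sigma^TB_iP_\sigma=B_i \text{ for all } i\}$, where $P_\sigma$ is the permutation matrix of $\sigma$. -}

module Defs where

open import Data.Nat using (ℕ; zero; suc; _+_)
open import Data.Integer as ℤ using (ℤ; +_; -_; _-_)
open import Data.Fin using (Fin; zero; suc; splitAt)
open import Data.Fin.Permutation using (Permutation′; _⟨$⟩ʳ_)
open import Data.Product using (_×_)
open import Data.Sum using (_⊎_; inj₁; inj₂)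
open import Relation.Binary.PropositionalEquality using (_≡_)

Mat : ℕ → Set
Mat k = Fin k → Fin k → ℤ

sumF : ∀ {k} → (Fin k → ℤ) → ℤ
sumF {zero}  f = + 0
sumF {suc k} f = f zero ℤ.+ sumF (λ i → f (suc i))

δ : ∀ {k} → Fin k → Fin k → ℤ
δ zero    zero    = + 1
δ zero    (suc j) = + 0
δ (suc i) zero    = + 0
δ (suc i) (suc j) = δ i j

I : ∀ {k} → Mat k
I = δ

_ᵀ : ∀ {k} → Mat k → Mat k
(M ᵀ) i j = M j i

_⊕_ : ∀ {k} → Mat k → Mat k → Mat k
(M ⊕ N) i j = M i j ℤ.+ N i j

_⊖_ : ∀ {k} → Mat k → Mat k → Mat k
(M ⊖ N) i j = M i j - N i j

neg : ∀ {k} → Mat k → Mat k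
neg M i j = - M i j

_⊛_ : ∀ {k} → Mat k → Mat k → Mat k
(M ⊛ N) i j = sumF (λ l → M i l ℤ.* N l j)

scal : ∀ {k} → ℤ → Mat k → Mat k
scal c M i j = c ℤ.* M i j

IsHadamard : ∀ k → Mat k → Set
IsHadamard k H = (∀ i j → (H i j ≡ + 1) ⊎ (H i j ≡ - + 1))
               × (H ⊛ (H ᵀ) ≡ scal (+ k) I)


IsSkewHadamard : ∀ k → Mat k → Set
IsSkewHadamard k H = IsHadamard k H × ((H ⊖ I) ᵀ ≡ neg (H ⊖ I))


Is01 : ∀ {m} → Mat m → Set
Is01 A = ∀ i j → (A i j ≡ + 0) ⊎ (A i j ≡ + 1)

Hmat : ∀ {m} → Mat m → Mat m → Mat (suc m)
Hmat A1 A2 zero    zero    = + 1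
Hmat A1 A2 zero    (suc j) = + 1
Hmat A1 A2 (suc i) zero    = - + 1
Hmat A1 A2 (suc i) (suc j) = ((I ⊕ A1) ⊖ A2) i j

data Block (m : ℕ) : Set where
  first  : Fin m → Block m
  middle : Block m
  third  : Fin m → Block m

block : ∀ m → Fin (m + suc m) → Block m
block m i with splitAt m i
... | inj₁ a       = first a
... | inj₂ zero    = middle
... | inj₂ (suc b) = third b

B1blk : ∀ {m} → Mat m → Mat m → Block m → Block m → ℤ
B1blk A1 A2 (first i) (first j) = A1 i j
B1blk A1 A2 (first i) middle    = + 0
B1blk A1 A2 (first i) (third j) = (I ⊕ A1) i j
B1blk A1 A2 middle    (first j) = + 1
B1blk A1 A2 middle    middle    = + 0
B1blk A1 A2 middle    (third j) = + 0
B1blk A1 A2 (third i) (first j) = A1 i j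
B1blk A1 A2 (third i) middle    = + 1
B1blk A1 A2 (third i) (third j) = A2 i j

B1 : ∀ {m} → Mat m → Mat m → Mat (m + suc m)
B1 {m} A1 A2 i j = B1blk A1 A2 (block m i) (block m j)

B0 : ∀ {m} → Mat (m + suc m)
B0 = I

B2 : ∀ {m} → Mat m → Mat m → Mat (m + suc m)
B2 A1 A2 = B1 A1 A2 ᵀ

-- σ preserves B under conjugation by permutation matrix: (P_σᵀ B P_σ)_{ij} = B_{σ i, σ j}
Preserves : ∀ {k} → Permutation′ k → Mat k → Set
Preserves σ B = ∀ i j → B (σ ⟨$⟩ʳ i) (σ ⟨$⟩ʳ j) ≡ B i j

IsAut : ∀ {m} → Mat m → Mat m → Permutation′ (m + suc m) → Set
IsAut A1 A2 σ = Preserves σ B0 × Preserves σ (B1 A1 A2) × Preserves σ (B2 A1 A2)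

-- Say that a vertex v of the digraph B1 has twins if every out-neighbour u of v has a
-- twin w: an in-neighbour of v with u → w such that u and w have the same weights
-- towards all out-neighbours of v. Automorphisms preserve this property. The middle
-- vertex has twins (the twin of the i-th vertex of the first block is the i-th vertex
-- of the third). No outer vertex does: the core C = I + A1 − A2 of H has row sums 1 and
-- distinct rows with inner product −1, so A1 is a regular tournament on m ≥ 7 vertices
-- and no two rows of C agree outside three positions, whereas a twin would force such
-- an agreement or contradict the tournament property outright. Hence every automorphism
-- fixes the middle vertex, and with it its out-neighbourhood (the first block) and its
-- in-neighbourhood (the third block).

module Submission where

open import Defs
open import Data.Nat as ℕ using (ℕ; zero; suc; z≤n; s≤s; z<s)
import Data.Nat.Properties as ℕP
open import Data.Integer as ℤ using (ℤ; +_; -_; _+_; _-_; _*_; _≤_; -≤+; +≤+)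
import Data.Integer.Properties as ℤP
open import Data.Integer.Tactic.RingSolver using (solve-∀)
open import Data.Fin using (Fin; zero; suc; toℕ; splitAt; _↑ˡ_; _↑ʳ_)
open import Data.Fin.Properties using (_≟_; any?; toℕ<n; toℕ-↑ˡ; toℕ-↑ʳ;
  splitAt-↑ˡ; splitAt-↑ʳ; splitAt⁻¹-↑ˡ; splitAt⁻¹-↑ʳ)
open import Data.Fin.Permutation using (Permutation′; _⟨$⟩ʳ_; _⟨$⟩ˡ_; inverseʳ)
open import Data.Product using (Σ-syntax; ∃-syntax; _×_; _,_; proj₁; proj₂)
open import Data.Sum using (_⊎_; inj₁; inj₂)
open import Data.Empty using (⊥-elim)
open import Relation.Binary.PropositionalEquality
open import Relation.Nullary using (yes; no; ¬_; ¬?)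
open import Relation.Nullary.Decidable using (_×-dec_)

Bit : ℤ → Set
Bit x = (x ≡ + 0) ⊎ (x ≡ + 1)

Sign : ℤ → Set
Sign x = (x ≡ + 1) ⊎ (x ≡ - + 1)

bit-≢0 : ∀ {x} → Bit x → x ≢ + 0 → x ≡ + 1
bit-≢0 (inj₁ x≡0) x≢0 = ⊥-elim (x≢0 x≡0)
bit-≢0 (inj₂ x≡1) _   = x≡1

bit-≢1 : ∀ {x} → Bit x → x ≢ + 1 → x ≡ + 0
bit-≢1 (inj₁ x≡0) _   = x≡0
bit-≢1 (inj₂ x≡1) x≢1 = ⊥-elim (x≢1 x≡1)

bits-sum-zero : ∀ {x y} → Bit x → Bit y → x + y ≡ + 0 → x ≡ + 0 × y ≡ + 0
bits-sum-zero (inj₁ refl) (inj₁ refl) _ = refl , refl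
bits-sum-zero (inj₁ refl) (inj₂ refl) ()
bits-sum-zero (inj₂ refl) (inj₁ refl) ()
bits-sum-zero (inj₂ refl) (inj₂ refl) ()

bits-zero-or-≥1 : ∀ {x y z} → Bit x → Bit y → Bit z →
                  (x ≡ + 0 × y ≡ + 0 × z ≡ + 0) ⊎ (+ 1 ≤ x + y + z)
bits-zero-or-≥1 (inj₁ refl) (inj₁ refl) (inj₁ refl) = inj₁ (refl , refl , refl)
bits-zero-or-≥1 (inj₁ refl) (inj₁ refl) (inj₂ refl) = inj₂ ℤP.≤-refl
bits-zero-or-≥1 (inj₁ refl) (inj₂ refl) (inj₁ refl) = inj₂ ℤP.≤-refl
bits-zero-or-≥1 (inj₁ refl) (inj₂ refl) (inj₂ refl) = inj₂ (+≤+ (s≤s z≤n))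
bits-zero-or-≥1 (inj₂ refl) (inj₁ refl) (inj₁ refl) = inj₂ ℤP.≤-refl
bits-zero-or-≥1 (inj₂ refl) (inj₁ refl) (inj₂ refl) = inj₂ (+≤+ (s≤s z≤n))
bits-zero-or-≥1 (inj₂ refl) (inj₂ refl) (inj₁ refl) = inj₂ (+≤+ (s≤s z≤n))
bits-zero-or-≥1 (inj₂ refl) (inj₂ refl) (inj₂ refl) = inj₂ (+≤+ (s≤s z≤n))

complement-bit : ∀ {x y} → Bit x → Bit y → Sign (x - y) → y ≡ + 1 - x
complement-bit (inj₁ refl) (inj₁ refl) (inj₁ ())
complement-bit (inj₁ refl) (inj₁ refl) (inj₂ ())
complement-bit (inj₁ refl) (inj₂ refl) _ = refl
complement-bit (inj₂ refl) (inj₁ refl) _ = refl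
complement-bit (inj₂ refl) (inj₂ refl) (inj₁ ())
complement-bit (inj₂ refl) (inj₂ refl) (inj₂ ())

bit-≢-complement : ∀ {x} → Bit x → x ≢ + 1 - x
bit-≢-complement (inj₁ refl) ()
bit-≢-complement (inj₂ refl) ()

1≢0 : + 1 ≢ + 0
1≢0 ()

≡1⇒≢0 : ∀ {x} → x ≡ + 1 → x ≢ + 0
≡1⇒≢0 refl ()

sign-neg : ∀ {x} → Sign x → Sign (- x)
sign-neg (inj₁ refl) = inj₂ refl
sign-neg (inj₂ refl) = inj₁ refl

sign-* : ∀ {x y} → Sign x → Sign y → Sign (x * y)
sign-* (inj₁ refl) (inj₁ refl) = inj₁ refl
sign-* (inj₁ refl) (inj₂ refl) = inj₂ refl
sign-* (inj₂ refl) (inj₁ refl) = inj₂ refl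
sign-* (inj₂ refl) (inj₂ refl) = inj₁ refl

sign-≥-1 : ∀ {x} → Sign x → - + 1 ≤ x
sign-≥-1 (inj₁ refl) = -≤+
sign-≥-1 (inj₂ refl) = ℤP.≤-refl

sign² : ∀ {x} → Sign x → x * x ≡ + 1
sign² (inj₁ refl) = refl
sign² (inj₂ refl) = refl

+-cancel-neg : ∀ c x → c + (- c + x) ≡ x
+-cancel-neg = solve-∀

k-6≰-1 : ∀ {k} → 7 ℕ.≤ k → ¬ (+ k - + 6 ≤ - + 1)
k-6≰-1 (s≤s (s≤s (s≤s (s≤s (s≤s (s≤s (s≤s z≤n))))))) ()

δ-refl : ∀ {k} (p : Fin k) → δ p p ≡ + 1
δ-refl zero    = refl
δ-refl (suc p) = δ-refl p

δ-≢ : ∀ {k} {p l : Fin k} → p ≢ l → δ p l ≡ + 0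
δ-≢ {p = zero}  {zero}  p≢l = ⊥-elim (p≢l refl)
δ-≢ {p = zero}  {suc l} _   = refl
δ-≢ {p = suc p} {zero}  _   = refl
δ-≢ {p = suc p} {suc l} p≢l = δ-≢ (λ p≡l → p≢l (cong suc p≡l))

δ-bit : ∀ {k} (p l : Fin k) → Bit (δ p l)
δ-bit zero    zero    = inj₂ refl
δ-bit zero    (suc l) = inj₁ refl
δ-bit (suc p) zero    = inj₁ refl
δ-bit (suc p) (suc l) = δ-bit p l

δ≡0⇒≢ : ∀ {k} {p l : Fin k} → δ p l ≡ + 0 → l ≢ p
δ≡0⇒≢ {p = p} δ≡0 refl with trans (sym (δ-refl p)) δ≡0
... | ()

δ-≢-+ : ∀ {k} {p l : Fin k} → p ≢ l → ∀ x → δ p l + x ≡ x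
δ-≢-+ p≢l x = trans (cong (λ d → d + x) (δ-≢ p≢l)) (ℤP.+-identityˡ x)

δ-+-≢0 : ∀ {k} (p l : Fin k) {x} → x ≡ + 1 → δ p l + x ≢ + 0
δ-+-≢0 p l refl δ+1≡0 with proj₂ (bits-sum-zero (δ-bit p l) (inj₂ refl) δ+1≡0)
... | ()

sumF-cong : ∀ {k} {f g : Fin k → ℤ} → (∀ l → f l ≡ g l) → sumF f ≡ sumF g
sumF-cong {zero}  _   = refl
sumF-cong {suc k} f≡g = cong₂ _+_ (f≡g zero) (sumF-cong (λ l → f≡g (suc l)))

sumF-mono-≤ : ∀ {k} {f g : Fin k → ℤ} → (∀ l → f l ≤ g l) → sumF f ≤ sumF g
sumF-mono-≤ {zero}  _   = ℤP.≤-refl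
sumF-mono-≤ {suc k} f≤g = ℤP.+-mono-≤ (f≤g zero) (sumF-mono-≤ (λ l → f≤g (suc l)))

sumF-+ : ∀ {k} (f g : Fin k → ℤ) → sumF (λ l → f l + g l) ≡ sumF f + sumF g
sumF-+ {zero}  f g = refl
sumF-+ {suc k} f g =
  trans (cong (_+_ (f zero + g zero)) (sumF-+ (λ l → f (suc l)) (λ l → g (suc l))))
        (+-interchange (f zero) (g zero) _ _)
  where
    +-interchange : ∀ a b c d → (a + b) + (c + d) ≡ (a + c) + (b + d)
    +-interchange = solve-∀

sumF-neg : ∀ {k} (f : Fin k → ℤ) → sumF (λ l → - f l) ≡ - sumF f
sumF-neg {zero}  f = refl
sumF-neg {suc k} f =
  trans (cong (_+_ (- f zero)) (sumF-neg (λ l → f (suc l)))) (sym (ℤP.neg-distrib-+ (f zero) _))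

sumF-zero : ∀ k → sumF {k} (λ _ → + 0) ≡ + 0
sumF-zero zero    = refl
sumF-zero (suc k) = trans (ℤP.+-identityˡ _) (sumF-zero k)

sumF-one : ∀ k → sumF {k} (λ _ → + 1) ≡ + k
sumF-one zero    = refl
sumF-one (suc k) = cong (_+_ (+ 1)) (sumF-one k)

sumF-δ : ∀ {k} (p : Fin k) → sumF (δ p) ≡ + 1
sumF-δ {suc k} zero    = cong (_+_ (+ 1)) (sumF-zero k)
sumF-δ {suc k} (suc p) = trans (ℤP.+-identityˡ _) (sumF-δ p)

sumF-≥-except₃ : ∀ {k} (f : Fin k → ℤ) (p q r : Fin k) → (∀ l → - + 1 ≤ f l) →
                 (∀ l → l ≢ p → l ≢ q → l ≢ r → f l ≡ + 1) → + k - + 6 ≤ sumF f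
sumF-≥-except₃ {k} f p q r f≥-1 f≡1 = begin
  + k - + 6    ≡⟨ sym sumF-weight ⟩
  sumF weight  ≤⟨ sumF-mono-≤ weight≤f ⟩
  sumF f       ∎
  where
    open ℤP.≤-Reasoning
    hits weight : Fin k → ℤ
    hits l   = δ p l + δ q l + δ r l
    weight l = + 1 - (hits l + hits l)

    sumF-hits : sumF hits ≡ + 3
    sumF-hits = trans (sumF-+ (λ l → δ p l + δ q l) (δ r))
      (cong₂ _+_ (trans (sumF-+ (δ p) (δ q)) (cong₂ _+_ (sumF-δ p) (sumF-δ q))) (sumF-δ r))

    sumF-weight : sumF weight ≡ + k - + 6
    sumF-weight = trans (sumF-+ (λ _ → + 1) (λ l → - (hits l + hits l)))
      (cong₂ _+_ (sumF-one k)
        (trans (sumF-neg (λ l → hits l + hits l))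
          (cong -_ (trans (sumF-+ hits hits) (cong₂ _+_ sumF-hits sumF-hits)))))

    weight≤f : ∀ l → weight l ≤ f l
    weight≤f l with bits-zero-or-≥1 (δ-bit p l) (δ-bit q l) (δ-bit r l)
    ... | inj₂ 1≤h = ℤP.≤-trans (ℤP.+-monoʳ-≤ (+ 1) (ℤP.neg-mono-≤ (ℤP.+-mono-≤ 1≤h 1≤h))) (f≥-1 l)
    ... | inj₁ (p0 , q0 , r0)
      rewrite p0 | q0 | r0 | f≡1 l (δ≡0⇒≢ p0) (δ≡0⇒≢ q0) (δ≡0⇒≢ r0) = ℤP.≤-refl

Arc : ∀ {V : Set} → (V → V → ℤ) → V → V → Set
Arc B v u = B v u ≢ + 0

HasTwins : ∀ {V : Set} → (V → V → ℤ) → V → Set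
HasTwins {V} B v = ∀ u → Arc B v u →
  Σ[ w ∈ V ] Arc B w v × Arc B u w × (∀ z → Arc B v z → B u z ≡ B w z)

module _ {V W : Set} {B : V → V → ℤ} {B′ : W → W → ℤ} (f : V → W) (g : W → V)
         (f∘g : ∀ y → f (g y) ≡ y) (pres : ∀ x y → B′ (f x) (f y) ≡ B x y) where
  open ≡-Reasoning

  private
    pres-from : ∀ x y → B′ (f x) y ≡ B x (g y)
    pres-from x y = trans (cong (B′ (f x)) (sym (f∘g y))) (pres x (g y))

    pres-to : ∀ x y → B′ x (f y) ≡ B (g x) y
    pres-to x y = trans (cong (λ x′ → B′ x′ (f y)) (sym (f∘g x))) (pres (g x) y)

  HasTwins-transport : ∀ {v} → HasTwins B v → HasTwins B′ (f v)
  HasTwins-transport {v} twins u v→u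
    with twins (g u) (λ e → v→u (trans (pres-from v u) e))
  ... | w , w→v , gu→w , agree =
    f w , (λ e → w→v (trans (sym (pres w v)) e)) , (λ e → gu→w (trans (sym (pres-to u w)) e)) ,
    λ z v→z → begin
      B′ u z          ≡⟨ cong (B′ u) (sym (f∘g z)) ⟩
      B′ u (f (g z))  ≡⟨ pres-to u (g z) ⟩
      B (g u) (g z)   ≡⟨ agree (g z) (λ e → v→z (trans (pres-from v z) e)) ⟩
      B w (g z)       ≡⟨ sym (pres-from w z) ⟩
      B′ (f w) z      ∎

unblock : ∀ {m} → Block m → Fin (m ℕ.+ suc m)
unblock {m} (first a) = a ↑ˡ suc m
unblock {m} middle    = m ↑ʳ zero
unblock {m} (third b) = m ↑ʳ suc b

block-unblock : ∀ {m} (b : Block m) → block m (unblock b) ≡ b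
block-unblock {m} (first a) rewrite splitAt-↑ˡ m a (suc m)       = refl
block-unblock {m} middle    rewrite splitAt-↑ʳ m (suc m) zero    = refl
block-unblock {m} (third b) rewrite splitAt-↑ʳ m (suc m) (suc b) = refl

unblock-block : ∀ {m} (i : Fin (m ℕ.+ suc m)) → unblock (block m i) ≡ i
unblock-block {m} i with splitAt m i in eq
... | inj₁ a       = splitAt⁻¹-↑ˡ eq
... | inj₂ zero    = splitAt⁻¹-↑ʳ eq
... | inj₂ (suc b) = splitAt⁻¹-↑ʳ eq

data Side : Set where
  below at above : Side

side : ∀ {m} → Block m → Side
side (first _) = below
side middle    = at
side (third _) = above

Cmp : Side → ℕ → ℕ → Set
Cmp below x m = x ℕ.< m
Cmp at    x m = x ≡ m
Cmp above x m = m ℕ.< x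

Cmp-unique : ∀ s t {x m} → Cmp s x m → Cmp t x m → s ≡ t
Cmp-unique below below _   _   = refl
Cmp-unique below at    x<m x≡m = ⊥-elim (ℕP.<-irrefl x≡m x<m)
Cmp-unique below above x<m m<x = ⊥-elim (ℕP.<-asym x<m m<x)
Cmp-unique at    below x≡m x<m = ⊥-elim (ℕP.<-irrefl x≡m x<m)
Cmp-unique at    at    _   _   = refl
Cmp-unique at    above x≡m m<x = ⊥-elim (ℕP.<-irrefl (sym x≡m) m<x)
Cmp-unique above below m<x x<m = ⊥-elim (ℕP.<-asym x<m m<x)
Cmp-unique above at    m<x x≡m = ⊥-elim (ℕP.<-irrefl (sym x≡m) m<x)
Cmp-unique above above _   _   = refl

Cmp-unblock : ∀ {m} (b : Block m) → Cmp (side b) (toℕ (unblock b)) m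
Cmp-unblock {m} (first a) = subst (ℕ._< m) (sym (toℕ-↑ˡ a (suc m))) (toℕ<n a)
Cmp-unblock {m} middle    = trans (toℕ-↑ʳ m zero) (ℕP.+-identityʳ m)
Cmp-unblock {m} (third b) = subst (m ℕ.<_) (sym (toℕ-↑ʳ m (suc b))) (ℕP.m<m+n m z<s)

Cmp-block : ∀ {m} (i : Fin (m ℕ.+ suc m)) → Cmp (side (block m i)) (toℕ i) m
Cmp-block {m} i = subst (λ j → Cmp (side (block m i)) (toℕ j) m) (unblock-block i) (Cmp-unblock (block m i))

middle-row : ∀ {m} {A1 A2 : Mat m} b → B1blk A1 A2 middle b ≡ + 1 → side b ≡ below
middle-row (first _) _ = refl
middle-row middle    ()
middle-row (third _) ()

middle-column : ∀ {m} {A1 A2 : Mat m} b → B1blk A1 A2 b middle ≡ + 1 → side b ≡ above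
middle-column (first _) ()
middle-column middle    ()
middle-column (third _) _ = refl

-- The first block is the out-neighbourhood of the middle vertex and the third block
-- its in-neighbourhood, so fixing the middle vertex fixes both.
module _ {m} {A1 A2 : Mat m} (σ : Permutation′ (m ℕ.+ suc m)) (pres : Preserves σ (B1 A1 A2))
         (fixes : ∀ {i} → block m i ≡ middle → block m (σ ⟨$⟩ʳ i) ≡ middle) where
  open ≡-Reasoning

  private
    c : Fin (m ℕ.+ suc m)
    c = unblock middle

    σc-middle : block m (σ ⟨$⟩ʳ c) ≡ middle
    σc-middle = fixes (block-unblock middle)

  side-preserved : ∀ i → side (block m (σ ⟨$⟩ʳ i)) ≡ side (block m i)
  side-preserved i with block m i in eq
  ... | first _ = middle-row _ (begin
    B1blk A1 A2 middle (block m (σ ⟨$⟩ʳ i))  ≡⟨ cong (λ b → B1blk A1 A2 b (block m (σ ⟨$⟩ʳ i))) (sym σc-middle) ⟩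
    B1 A1 A2 (σ ⟨$⟩ʳ c) (σ ⟨$⟩ʳ i)            ≡⟨ pres c i ⟩
    B1blk A1 A2 (block m c) (block m i)       ≡⟨ cong₂ (B1blk A1 A2) (block-unblock middle) eq ⟩
    + 1                                       ∎)
  ... | middle  = cong side (fixes eq)
  ... | third _ = middle-column _ (begin
    B1blk A1 A2 (block m (σ ⟨$⟩ʳ i)) middle  ≡⟨ cong (B1blk A1 A2 (block m (σ ⟨$⟩ʳ i))) (sym σc-middle) ⟩
    B1 A1 A2 (σ ⟨$⟩ʳ i) (σ ⟨$⟩ʳ c)            ≡⟨ pres i c ⟩
    B1blk A1 A2 (block m i) (block m c)       ≡⟨ cong₂ (B1blk A1 A2) eq (block-unblock middle) ⟩
    + 1                                       ∎)

module Scheme (m : ℕ) (7≤m : 7 ℕ.≤ m) (A1 A2 : Mat m) (A1-bit : Is01 A1)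
              (A2≡A1ᵀ : ∀ i j → A2 i j ≡ A1 j i) (hadamard : IsHadamard (suc m) (Hmat A1 A2)) where

  open ≡-Reasoning

  C : Fin m → Fin m → ℤ
  C a l = Hmat A1 A2 (suc a) (suc l)

  C-sign : ∀ a l → Sign (C a l)
  C-sign a l = proj₁ hadamard (suc a) (suc l)

  orthogonal : ∀ i j → sumF (λ l → Hmat A1 A2 i l * Hmat A1 A2 j l) ≡ + suc m * δ i j
  orthogonal i j = cong (λ M → M i j) (proj₂ hadamard)

  C-row-sum : ∀ a → sumF (C a) ≡ + 1
  C-row-sum a = begin
    sumF (C a)                                 ≡⟨ sumF-cong (λ l → sym (ℤP.*-identityˡ (C a l))) ⟩
    sumF (λ l → + 1 * C a l)                   ≡⟨ sym (+-cancel-neg (+ 1) _) ⟩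
    + 1 + (- + 1 + sumF (λ l → + 1 * C a l))   ≡⟨ cong (_+_ (+ 1)) (orthogonal zero (suc a)) ⟩
    + 1 + + suc m * + 0                        ≡⟨ cong (_+_ (+ 1)) (ℤP.*-zeroʳ (+ suc m)) ⟩
    + 1                                        ∎

  C-rows-orthogonal : ∀ {j b} → j ≢ b → sumF (λ l → C j l * C b l) ≡ - + 1
  C-rows-orthogonal {j} {b} j≢b = begin
    sumF (λ l → C j l * C b l)                    ≡⟨ sym (+-cancel-neg (- + 1) _) ⟩
    - + 1 + (+ 1 + sumF (λ l → C j l * C b l))    ≡⟨ cong (_+_ (- + 1)) (orthogonal (suc j) (suc b)) ⟩
    - + 1 + + suc m * δ j b                       ≡⟨ cong (λ d → - + 1 + + suc m * d) (δ-≢ j≢b) ⟩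
    - + 1 + + suc m * + 0                         ≡⟨ cong (_+_ (- + 1)) (ℤP.*-zeroʳ (+ suc m)) ⟩
    - + 1                                         ∎

  tournament : ∀ {a l} → a ≢ l → A1 l a ≡ + 1 - A1 a l
  tournament {a} {l} a≢l = complement-bit (A1-bit a l) (A1-bit l a) (subst Sign C≡ (C-sign a l))
    where
      C≡ : C a l ≡ A1 a l - A1 l a
      C≡ = cong₂ _-_ (δ-≢-+ a≢l (A1 a l)) (A2≡A1ᵀ a l)

  A1-asym : ∀ {a l} → a ≢ l → A1 a l ≡ + 1 → A1 l a ≡ + 0
  A1-asym a≢l a→l = trans (tournament a≢l) (cong (_-_ (+ 1)) a→l)

  C-off-diagonal : ∀ {a l} → a ≢ l → C a l ≡ A1 a l - (+ 1 - A1 a l)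
  C-off-diagonal {a} {l} a≢l =
    cong₂ _-_ (δ-≢-+ a≢l (A1 a l)) (trans (A2≡A1ᵀ a l) (tournament a≢l))

  sumF-≢-1 : (f : Fin m → ℤ) (p q r : Fin m) → (∀ l → Sign (f l)) →
             (∀ l → l ≢ p → l ≢ q → l ≢ r → f l ≡ + 1) → sumF f ≢ - + 1
  sumF-≢-1 f p q r f-sign f≡1 sum≡-1 =
    k-6≰-1 7≤m (subst (_≤_ (+ m - + 6)) sum≡-1 (sumF-≥-except₃ f p q r (λ l → sign-≥-1 (f-sign l)) f≡1))

  -- C has row sums 1, so the tournament A1 is regular and a has (m − 1)/2 ≥ 3 out-neighbours.
  out-neighbour : ∀ a q → ∃[ l ] l ≢ a × l ≢ q × A1 a l ≡ + 1
  out-neighbour a q with any? (λ l → ¬? (l ≟ a) ×-dec ¬? (l ≟ q) ×-dec A1 a l ℤ.≟ + 1)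
  ... | yes found = found
  ... | no none   = ⊥-elim (sumF-≢-1 (λ l → - C a l) a q q (λ l → sign-neg (C-sign a l)) negC≡1
                      (trans (sumF-neg (C a)) (cong -_ (C-row-sum a))))
    where
      negC≡1 : ∀ l → l ≢ a → l ≢ q → l ≢ q → - C a l ≡ + 1
      negC≡1 l l≢a l≢q _ = cong -_ (trans (C-off-diagonal (≢-sym l≢a))
        (cong (λ x → x - (+ 1 - x)) (bit-≢1 (A1-bit a l) (λ a→l → none (l , l≢a , l≢q , a→l)))))

  B : Block m → Block m → ℤ
  B = B1blk A1 A2

  -- Nothing forces A1 a a = 0, but δ a a + A1 a a is nonzero either way.
  diagonal-arc : ∀ a → Arc B (first a) (third a)
  diagonal-arc a e = 1≢0 (trans (sym (δ-refl a)) (proj₁ (bits-sum-zero (δ-bit a a) (A1-bit a a) e)))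

  middle-hasTwins : HasTwins B middle
  middle-hasTwins (first a) _   = third a , (λ ()) , diagonal-arc a , agree
    where
      agree : ∀ z → Arc B middle z → B (first a) z ≡ B (third a) z
      agree (first l) _   = refl
      agree middle    m→m = ⊥-elim (m→m refl)
      agree (third l) m→t = ⊥-elim (m→t refl)
  middle-hasTwins middle    m→m = ⊥-elim (m→m refl)
  middle-hasTwins (third a) m→t = ⊥-elim (m→t refl)

  first-¬hasTwins : ∀ a → ¬ HasTwins B (first a)
  first-¬hasTwins a twins with out-neighbour a a
  ... | j , j≢a , _ , a→j with out-neighbour a j
  ... | l , l≢a , l≢j , a→l with twins (first j) (≡1⇒≢0 a→j)
  ... | middle  , _   , j↛mid , _     = j↛mid refl
  ... | first b , b→a , _     , agree =
    b→a (proj₂ (bits-sum-zero (δ-bit b a) (A1-bit b a) (trans (sym (agree (third a) (diagonal-arc a))) j↛a)))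
    where
      j↛a : δ j a + A1 j a ≡ + 0
      j↛a = trans (δ-≢-+ j≢a _) (A1-asym (≢-sym j≢a) a→j)
  ... | third b , b→a , _     , agree = bit-≢-complement (A1-bit b l) (begin
    A1 b l          ≡⟨ sym (agree (first l) (≡1⇒≢0 a→l)) ⟩
    A1 j l          ≡⟨ sym (δ-≢-+ (≢-sym l≢j) _) ⟩
    δ j l + A1 j l  ≡⟨ agree (third l) (δ-+-≢0 a l a→l) ⟩
    A2 b l          ≡⟨ A2≡A1ᵀ b l ⟩
    A1 l b          ≡⟨ tournament b≢l ⟩
    + 1 - A1 b l    ∎)
    where
      b≢l : b ≢ l
      b≢l refl = 1≢0 (trans (sym (bit-≢0 (A1-bit b a) b→a)) (A1-asym (≢-sym l≢a) a→l))

  third-¬hasTwins : ∀ a → ¬ HasTwins B (third a)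
  third-¬hasTwins a twins with out-neighbour a a
  ... | j , j≢a , _ , a→j with twins (first j) (≡1⇒≢0 a→j)
  ... | middle  , _   , j↛mid , _     = j↛mid refl
  ... | third b , _   , _     , agree = 1≢0 (sym (agree middle (λ ())))
  ... | first b , b→a , j→b   , agree =
    sumF-≢-1 (λ l → C j l * C b l) a j b (λ l → sign-* (C-sign j l) (C-sign b l)) products
      (C-rows-orthogonal j≢b)
    where
      b≢a : b ≢ a
      b≢a refl = j→b (A1-asym (≢-sym j≢a) a→j)

      ba : A1 b a ≡ + 1
      ba = bit-≢0 (A1-bit b a) (λ e → b→a (trans (δ-≢-+ b≢a _) e))

      j≢b : j ≢ b
      j≢b refl = 1≢0 (trans (sym a→j) (A1-asym b≢a ba))

      rows-agree : ∀ l → l ≢ a → l ≢ j → l ≢ b → A1 j l ≡ A1 b l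
      rows-agree l l≢a l≢j l≢b with A1-bit a l
      ... | inj₂ a→l = agree (first l) (≡1⇒≢0 a→l)
      ... | inj₁ a↛l = begin
        A1 j l          ≡⟨ sym (δ-≢-+ (≢-sym l≢j) _) ⟩
        δ j l + A1 j l  ≡⟨ agree (third l) (≡1⇒≢0 (trans (A2≡A1ᵀ a l) l→a)) ⟩
        δ b l + A1 b l  ≡⟨ δ-≢-+ (≢-sym l≢b) _ ⟩
        A1 b l          ∎
        where
          l→a : A1 l a ≡ + 1
          l→a = trans (tournament (≢-sym l≢a)) (cong (_-_ (+ 1)) a↛l)

      products : ∀ l → l ≢ a → l ≢ j → l ≢ b → C j l * C b l ≡ + 1
      products l l≢a l≢j l≢b = begin
        C j l * C b l  ≡⟨ cong (_*_ (C j l)) C-agree ⟩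
        C j l * C j l  ≡⟨ sign² (C-sign j l) ⟩
        + 1            ∎
        where
          C-agree : C b l ≡ C j l
          C-agree = begin
            C b l                    ≡⟨ C-off-diagonal (≢-sym l≢b) ⟩
            A1 b l - (+ 1 - A1 b l)  ≡⟨ cong (λ x → x - (+ 1 - x)) (sym (rows-agree l l≢a l≢j l≢b)) ⟩
            A1 j l - (+ 1 - A1 j l)  ≡⟨ sym (C-off-diagonal (≢-sym l≢j)) ⟩
            C j l                    ∎

  hasTwins⇒middle : ∀ b → HasTwins B b → b ≡ middle
  hasTwins⇒middle (first a) twins = ⊥-elim (first-¬hasTwins a twins)
  hasTwins⇒middle middle    _     = refl
  hasTwins⇒middle (third a) twins = ⊥-elim (third-¬hasTwins a twins)

  aut-fixes-middle : (σ : Permutation′ (m ℕ.+ suc m)) → Preserves σ (B1 A1 A2) →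
                     ∀ {i} → block m i ≡ middle → block m (σ ⟨$⟩ʳ i) ≡ middle
  aut-fixes-middle σ pres {i} i-middle = hasTwins⇒middle _
    (HasTwins-transport (block m) unblock block-unblock (λ _ _ → refl)
      (HasTwins-transport (σ ⟨$⟩ʳ_) (σ ⟨$⟩ˡ_) (λ _ → inverseʳ σ) pres
        (subst (HasTwins (B1 A1 A2)) unblock-middle
          (HasTwins-transport unblock (block m) unblock-block
            (λ b c → cong₂ B (block-unblock b) (block-unblock c)) middle-hasTwins))))
    where
      unblock-middle : unblock middle ≡ i
      unblock-middle = trans (cong unblock (sym i-middle)) (unblock-block i)

lemma2 : (m : ℕ) → 8 ℕ.≤ suc m → (A1 A2 : Mat m) → Is01 A1 → Is01 A2 →
    (∀ i j → A2 i j ≡ A1 j i) → IsSkewHadamard (suc m) (Hmat A1 A2) →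
    (σ : Permutation′ (m ℕ.+ suc m)) → IsAut A1 A2 σ →
    (∀ i → toℕ i ℕ.< m → toℕ (σ ⟨$⟩ʳ i) ℕ.< m)
    × (∀ i → toℕ i ≡ m → toℕ (σ ⟨$⟩ʳ i) ≡ m)
    × (∀ i → m ℕ.< toℕ i → m ℕ.< toℕ (σ ⟨$⟩ʳ i))
lemma2 m 8≤1+m A1 A2 A1-bit _ A2≡A1ᵀ (hadamard , _) σ (_ , B1-preserved , _) =
  preserves below , preserves at , preserves above
  where
    open Scheme m (ℕ.s≤s⁻¹ 8≤1+m) A1 A2 A1-bit A2≡A1ᵀ hadamard

    preserves : ∀ s i → Cmp s (toℕ i) m → Cmp s (toℕ (σ ⟨$⟩ʳ i)) m
    preserves s i i-in-s = subst (λ t → Cmp t (toℕ (σ ⟨$⟩ʳ i)) m)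
      (trans (side-preserved σ B1-preserved (aut-fixes-middle σ B1-preserved) i)
             (Cmp-unique _ s (Cmp-block i) i-in-s))
      (Cmp-block (σ ⟨$⟩ʳ i))
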